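{- Let $V=\{v_1,\dots,v_n\}$, let $b$ be an integer with $|b|<\binom{n}{2}$, and let $G$ be a finite simple graph on the vertex set $V$ with no isolated vertices and with $|E(G)|=\frac12\left(\binom{n}{2}-b\right)$. Then $G$ is a quasi $f$-graph of type $(0,b)$ if and only if the complementary graph $\overline{G}$ of $G$ is triangle-free.
   Context: Let $k$ be a field and $R=k[x_1,\dots,x_n]$, the variable $x_i$ corresponding to the vertex $v_i$. For $F\subseteq V$ write $x_F=\prod_{v_i\in F}x_i$. For a square-free monomial ideal $I\subseteq R$ with minimal monomial generating set $G(I)$: the facet complex $\delta_{\mathcal F}(I)$ is the simplicial complex whose facets are the sets $\{v_{i_1},\dots,v_{i_r}\}$ with $x_{i_1}\cdots x_{i_r}\in G(I)$; the non-face complex $\delta_{\mathcal N}(I)$ is $\{F\subseteq V : x_F\notin I\}$. The $f$-vector of a $d$-dimensional simplicial complex is $(f_0,\dots,f_d)$, $f_i$ the number of faces with $i+1$ elements. $I$ is a quasi $f$-ideal of type $(a_1,\dots,a_s)\in\mathbb Z^s$ if $f(\delta_{\mathcal N}(I))-f(\delta_{\mathcal F}(I))=(a_1,\dots,a_s)$, both $f$-vectors lying in $\mathbb Z^s$. A graph $G$ on $V$ is a quasi $f$-graph of type $(0,b)$ if its edge ideal $I(G)=(x_ix_j:\{v_i,v_j\}\in E(G))$ is a quasi $f$-ideal of type $(0,b)$. -}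

module Defs where

open import Data.Bool using (Bool; true; false; not; _∧_; _∨_; if_then_else_)
open import Data.Nat using (ℕ; zero; suc; _≤_; _<_; _<ᵇ_)
open import Data.Integer as ℤ using (ℤ; +_; _-_)
open import Data.Fin using (Fin; toℕ)
open import Data.Fin.Subset using (Subset; inside; outside; _⊆_; ∣_∣; ⁅_⁆; _∪_)
open import Data.Fin.Subset.Properties using (_⊆?_)
open import Data.List using (List; []; _∷_; _++_; map; length; lookup; concatMap; allFin)
open import Data.Bool.ListAction using (any)
open import Data.Vec using ([]; _∷_)
open import Data.Product using (_×_; ∃-syntax)
open import Relation.Nullary using (does; ¬_)
open import Relation.Binary.PropositionalEquality using (_≡_; _≢_)
import Data.Nat as ℕ

record Graph (n : ℕ) : Set where
  field
    adj    : Fin n → Fin n → Bool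
    adj-sym    : ∀ i j → adj i j ≡ adj j i
    adj-irrefl : ∀ i → adj i i ≡ false
open Graph public

complement : ∀ {n} → Graph n → Graph n
complement {n} G = record { adj = cadj ; adj-sym = csym ; adj-irrefl = cirr }
  where
  open import Data.Fin using (_≟_)
  open import Relation.Nullary using (yes; no)
  open import Relation.Binary.PropositionalEquality using (refl; cong; sym)
  cadj : Fin n → Fin n → Bool
  cadj i j = if does (i ≟ j) then false else not (adj G i j)
  csym : ∀ i j → cadj i j ≡ cadj j i
  csym i j with i ≟ j | j ≟ i
  ... | yes _ | yes _ = refl
  ... | yes p | no q = Data.Empty.⊥-elim (q (sym p)) where import Data.Empty
  ... | no q | yes p = Data.Empty.⊥-elim (q (sym p)) where import Data.Empty
  ... | no _ | no _ = cong not (Graph.adj-sym G i j)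
  cirr : ∀ i → cadj i i ≡ false
  cirr i with i ≟ i
  ... | yes _ = refl
  ... | no q = Data.Empty.⊥-elim (q refl) where import Data.Empty

edges : ∀ {n} → Graph n → List (Subset n)
edges {n} G = concatMap (λ i → concatMap (λ j →
                 if (toℕ i <ᵇ toℕ j) ∧ adj G i j then (⁅ i ⁆ ∪ ⁅ j ⁆) ∷ [] else []) (allFin n)) (allFin n)

numEdges : ∀ {n} → Graph n → ℕ
numEdges G = length (edges G)

NoIsolated : ∀ {n} → Graph n → Set
NoIsolated {n} G = ∀ (i : Fin n) → ∃[ j ] (adj G i j ≡ true)

TriangleFree : ∀ {n} → Graph n → Set
TriangleFree {n} G = ¬ (∃[ i ] ∃[ j ] ∃[ k ]
  (adj G i j ≡ true × adj G j k ≡ true × adj G i k ≡ true))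

-- Square-free monomial ideals, given by their minimal generating set G(I),
-- each generator x_F represented by its support F ⊆ V.

SqFreeIdeal : ℕ → Set
SqFreeIdeal n = List (Subset n)

allSubsets : (n : ℕ) → List (Subset n)
allSubsets zero    = [] ∷ []
allSubsets (suc n) = map (outside ∷_) (allSubsets n) ++ map (inside ∷_) (allSubsets n)

Complex : ℕ → Set
Complex n = Subset n → Bool

facetComplex : ∀ {n} → SqFreeIdeal n → Complex n
facetComplex gens F = any (λ g → does (F ⊆? g)) gens

-- non-face complex δ_N(I) = {F : x_F ∉ I}; a monomial x_F lies in the monomial
-- ideal I iff some generator x_g divides it, i.e. g ⊆ F
nonFaceComplex : ∀ {n} → SqFreeIdeal n → Complex n
nonFaceComplex gens F = not (any (λ g → does (g ⊆? F)) gens)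

countB : ∀ {A : Set} → (A → Bool) → List A → ℕ
countB p [] = 0
countB p (x ∷ xs) = if p x then suc (countB p xs) else countB p xs

-- f-vector entry f_i : number of faces with i+1 elements
fvec : ∀ {n} → Complex n → ℕ → ℕ
fvec {n} Δ i = countB (λ F → Δ F ∧ (∣ F ∣ ℕ.≡ᵇ suc i)) (allSubsets n)

-- I is a quasi f-ideal of type (a_1,…,a_s): both f-vectors lie in ℤ^s
-- (i.e. f_i = 0 for i ≥ s, f-vectors padded with zeros) and
-- f_i(δ_N(I)) - f_i(δ_F(I)) = a_{i+1} for 0 ≤ i < s.
IsQuasiFIdeal : ∀ {n} → SqFreeIdeal n → List ℤ → Set
IsQuasiFIdeal I as =
  (∀ (i : Fin (length as)) →
     + fvec (nonFaceComplex I) (toℕ i) - + fvec (facetComplex I) (toℕ i) ≡ lookup as i)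
  × (∀ i → length as ≤ i → fvec (nonFaceComplex I) i ≡ 0 × fvec (facetComplex I) i ≡ 0)

-- edge ideal I(G) = (x_i x_j : {v_i,v_j} ∈ E(G)); its minimal generators are the edges
edgeIdeal : ∀ {n} → Graph n → SqFreeIdeal n
edgeIdeal G = edges G

IsQuasiFGraph : ∀ {n} → Graph n → List ℤ → Set
IsQuasiFGraph G as = IsQuasiFIdeal (edgeIdeal G) as

-- The non-face complex of the edge ideal I(G) is the independence complex of G,
-- and its facet complex consists of the edges of G together with their subsets.
-- Since G has no isolated vertex, both complexes contain all n vertices. In
-- dimension 1 the facet complex has the |E(G)| edges and the non-face complex the
-- C(n,2) − |E(G)| non-edges, so 2|E(G)| = C(n,2) − b makes the difference b.
-- The facet complex has no larger faces, so G is a quasi f-graph of type (0,b)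
-- exactly when G has no independent set of size 3, i.e. when the complement of
-- G has no triangle.

module Submission where

open import Defs
open import Data.Bool using (Bool; true; false; not; _∧_; if_then_else_)
open import Data.Bool.ListAction using (any)
open import Data.Bool.Properties using (∧-zeroʳ; ∧-identityʳ; ∧-conicalʳ; T-≡; ¬-not; not-¬; not-injective; ⇔→≡)
open import Data.Fin using (Fin; zero; suc; toℕ; _≟_)
open import Data.Fin.Properties using (suc-injective; <-cmp; <⇒≢)
open import Data.Fin.Subset using (Subset; inside; outside; ⊥; ⁅_⁆; _∪_; _∈_; _∉_; _⊆_)
  renaming (∣_∣ to ∣_∣ˢ)
open import Data.Fin.Subset.Properties
  using ( _⊆?_; ∪-identityˡ; ∪-comm; x∈⁅x⁆; x∈⁅y⁆⇒x≡y; x≢y⇒x∉⁅y⁆; ∣⁅x⁆∣≡1; p⊆p∪q; q⊆p∪q; x∈p∪q⁻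
        ; p⊂q⇒∣p∣<∣q∣; p⊆q⇒∣p∣≤∣q∣)
open import Data.Integer as ℤ using (ℤ; +_; _-_; _*_; ∣_∣)
open import Data.Integer.Properties using (pos-+; +-inverseʳ)
open import Data.Integer.Tactic.RingSolver using (solve-∀)
open import Data.List using (List; []; _∷_; _++_; map; length; concatMap; allFin; tabulate; lookup)
open import Data.List.Membership.Propositional using (find; lose) renaming (_∈_ to _∈ₗ_)
open import Data.List.Membership.Propositional.Properties
  using (∈-map⁺; ∈-++⁺ˡ; ∈-++⁺ʳ; ∈-concatMap⁺; ∈-concatMap⁻; ∈-allFin)
open import Data.List.Properties using (length-++; map-tabulate; concatMap-map)
open import Data.List.Relation.Unary.Any using (here; there)
open import Data.List.Relation.Unary.Any.Properties using (any⁺; any⁻)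
open import Data.Nat using (ℕ; zero; suc; _+_; _≤_; _<_; _≡ᵇ_; _<ᵇ_; z≤n; s≤s)
open import Data.Nat.Combinatorics using (_C_; nC1≡n; nCk+nC[k+1]≡[n+1]C[k+1])
open import Data.Nat.Properties
  using ( +-comm; +-suc; +-monoʳ-≤; +-monoˡ-≤; n≤1+n; ≤-refl; ≤-trans; ≤-antisym; <⇒≱; _≤?_; ≰⇒>
        ; <ᵇ⇒<; <⇒<ᵇ; ≡ᵇ⇒≡; ≡⇒≡ᵇ; +-0-commutativeMonoid; +-commutativeSemigroup)
open import Data.Product using (_×_; _,_; proj₁; ∃-syntax)
open import Data.Sum using (_⊎_; inj₁; inj₂; [_,_]; map₂)
open import Data.Vec using ([]; _∷_; here; there)
open import Function using (_∘_; id)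
open import Function.Bundles using (_⇔_; Equivalence; mk⇔)
open import Relation.Binary.Definitions using (tri<; tri≈; tri>)
open import Relation.Binary.PropositionalEquality
  using (_≡_; _≢_; refl; sym; trans; cong; cong₂; subst; subst₂; module ≡-Reasoning)
open import Relation.Nullary using (Dec; does; yes; no; contradiction)
open import Relation.Nullary.Decidable using (dec-true)

open import Algebra.Properties.CommutativeMonoid.Sum +-0-commutativeMonoid using (sum-syntax; sum-cong-≗; ∑-distrib-+)
open import Algebra.Properties.CommutativeSemigroup +-commutativeSemigroup using (interchange)

countB-++ : ∀ {A : Set} (p : A → Bool) (xs ys : List A) → countB p (xs ++ ys) ≡ countB p xs + countB p ys
countB-++ p []       ys = refl
countB-++ p (x ∷ xs) ys with p x
... | true  = cong suc (countB-++ p xs ys)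
... | false = countB-++ p xs ys

countB-map : ∀ {A B : Set} (p : B → Bool) (f : A → B) (xs : List A) → countB p (map f xs) ≡ countB (p ∘ f) xs
countB-map p f []       = refl
countB-map p f (x ∷ xs) with p (f x)
... | true  = cong suc (countB-map p f xs)
... | false = countB-map p f xs

countB-none : ∀ {A : Set} (p : A → Bool) (xs : List A) → (∀ x → p x ≡ false) → countB p xs ≡ 0
countB-none p []       none = refl
countB-none p (x ∷ xs) none rewrite none x = countB-none p xs none

countB≡0⇒false : ∀ {A : Set} (p : A → Bool) (xs : List A) {x} → countB p xs ≡ 0 → x ∈ₗ xs → p x ≡ false
countB≡0⇒false p (y ∷ xs) c x∈ with p y in py
countB≡0⇒false p (y ∷ xs) () x∈        | true
countB≡0⇒false p (y ∷ xs) c (here refl) | false = py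
countB≡0⇒false p (y ∷ xs) c (there x∈) | false = countB≡0⇒false p xs c x∈

indicator : Bool → ℕ
indicator b = if b then 1 else 0

∑-const-1 : ∀ n → ∑[ i < n ] 1 ≡ n
∑-const-1 zero    = refl
∑-const-1 (suc n) = cong suc (∑-const-1 n)

∑-indicator-complement : ∀ n (r : Fin n → Bool) → ∑[ i < n ] indicator (not (r i)) + ∑[ i < n ] indicator (r i) ≡ n
∑-indicator-complement n r = begin
  ∑[ i < n ] indicator (not (r i)) + ∑[ i < n ] indicator (r i) ≡⟨ ∑-distrib-+ (indicator ∘ not ∘ r) (indicator ∘ r) ⟨
  ∑[ i < n ] (indicator (not (r i)) + indicator (r i))         ≡⟨ sum-cong-≗ (λ i → split (r i)) ⟩
  ∑[ i < n ] 1                                                 ≡⟨ ∑-const-1 n ⟩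
  n                                                            ∎
  where
  open ≡-Reasoning
  split : ∀ b → indicator (not b) + indicator b ≡ 1
  split true  = refl
  split false = refl

length-concatMap-allFin : ∀ {A : Set} n (f : Fin n → List A) → length (concatMap f (allFin n)) ≡ ∑[ i < n ] length (f i)
length-concatMap-allFin zero    f = refl
length-concatMap-allFin (suc n) f = begin
  length (f zero ++ concatMap f (tabulate suc))           ≡⟨ length-++ (f zero) ⟩
  length (f zero) + length (concatMap f (tabulate suc))   ≡⟨ cong (λ xs → length (f zero) + length (concatMap f xs)) (map-tabulate id suc) ⟨
  length (f zero) + length (concatMap f (map suc (allFin n))) ≡⟨ cong (λ xs → length (f zero) + length xs) (concatMap-map f suc (allFin n)) ⟩
  length (f zero) + length (concatMap (f ∘ suc) (allFin n)) ≡⟨ cong₂ _+_ refl (length-concatMap-allFin n (f ∘ suc)) ⟩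
  ∑[ i < suc n ] length (f i)                              ∎
  where open ≡-Reasoning

length-if : ∀ {A : Set} b (x : A) → length (if b then x ∷ [] else []) ≡ indicator b
length-if true  x = refl
length-if false x = refl

∈-if⁻ : ∀ {A : Set} b {x y : A} → x ∈ₗ (if b then y ∷ [] else []) → b ≡ true × x ≡ y
∈-if⁻ true (here x≡y) = refl , x≡y

any≡true⁺ : ∀ {A : Set} (p : A → Bool) {x xs} → x ∈ₗ xs → p x ≡ true → any p xs ≡ true
any≡true⁺ p x∈ px = Equivalence.to T-≡ (any⁺ p (lose x∈ (Equivalence.from T-≡ px)))

any≡true⁻ : ∀ {A : Set} (p : A → Bool) xs → any p xs ≡ true → ∃[ x ] (x ∈ₗ xs × p x ≡ true)
any≡true⁻ p xs anyp = let x , x∈ , px = find (any⁻ p xs (Equivalence.from T-≡ anyp)) in x , x∈ , Equivalence.to T-≡ px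

does≡true⇒ : ∀ {P : Set} (P? : Dec P) → does P? ≡ true → P
does≡true⇒ (yes p) _  = p
does≡true⇒ (no _)  ()

countPairs : ∀ {n} → (Fin n → Fin n → Bool) → ℕ
countPairs {n} q = ∑[ i < n ] ∑[ j < n ] indicator ((toℕ i <ᵇ toℕ j) ∧ q i j)

countPairs-complement : ∀ n (q : Fin n → Fin n → Bool) → countPairs (λ i j → not (q i j)) + countPairs q ≡ n C 2
countPairs-complement zero    q = refl
countPairs-complement (suc n) q = begin
  (a' + b') + (a + b) ≡⟨ interchange a' b' a b ⟩
  (a' + a) + (b' + b) ≡⟨ cong₂ _+_ (trans (∑-indicator-complement n (λ j → q zero (suc j))) (sym (nC1≡n n)))
                                   (countPairs-complement n (λ i j → q (suc i) (suc j))) ⟩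
  n C 1 + n C 2       ≡⟨ nCk+nC[k+1]≡[n+1]C[k+1] n 1 ⟩
  suc n C 2           ∎
  where
  open ≡-Reasoning
  a' = ∑[ j < n ] indicator (not (q zero (suc j)))
  a  = ∑[ j < n ] indicator (q zero (suc j))
  b' = countPairs (λ i j → not (q (suc i) (suc j)))
  b  = countPairs (λ i j → q (suc i) (suc j))

countPairs-cong : ∀ {n} {q q' : Fin n → Fin n → Bool} → (∀ i j → toℕ i < toℕ j → q i j ≡ q' i j) → countPairs q ≡ countPairs q'
countPairs-cong {q = q} {q'} q≐q' = sum-cong-≗ λ i → sum-cong-≗ λ j → cell i j
  where
  cell : ∀ i j → indicator ((toℕ i <ᵇ toℕ j) ∧ q i j) ≡ indicator ((toℕ i <ᵇ toℕ j) ∧ q' i j)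
  cell i j with toℕ i <ᵇ toℕ j in i<j
  ... | false = refl
  ... | true  = cong indicator (q≐q' i j (<ᵇ⇒< (toℕ i) (toℕ j) (Equivalence.from T-≡ i<j)))

∈-allSubsets : ∀ n (F : Subset n) → F ∈ₗ allSubsets n
∈-allSubsets zero    []            = here refl
∈-allSubsets (suc n) (outside ∷ F) = ∈-++⁺ˡ (∈-map⁺ (outside ∷_) (∈-allSubsets n F))
∈-allSubsets (suc n) (inside ∷ F)  = ∈-++⁺ʳ (map (outside ∷_) (allSubsets n)) (∈-map⁺ (inside ∷_) (∈-allSubsets n F))

-- Counting subsets by size

-- fvec Δ i unfolds to countOfSize Δ (suc i).
countOfSize : ∀ {n} → (Subset n → Bool) → ℕ → ℕ
countOfSize {n} p k = countB (λ F → p F ∧ (∣ F ∣ˢ ≡ᵇ k)) (allSubsets n)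

countOfSize-suc : ∀ n (p : Subset (suc n) → Bool) k →
  countOfSize p k ≡ countOfSize (p ∘ (outside ∷_)) k + countB (λ F → p (inside ∷ F) ∧ (suc ∣ F ∣ˢ ≡ᵇ k)) (allSubsets n)
countOfSize-suc n p k = trans (countB-++ _ (map (outside ∷_) (allSubsets n)) _)
  (cong₂ _+_ (countB-map _ (outside ∷_) (allSubsets n)) (countB-map _ (inside ∷_) (allSubsets n)))

countOfSize-0 : ∀ n (p : Subset n → Bool) → countOfSize p 0 ≡ indicator (p ⊥)
countOfSize-0 zero    p with p []
... | true  = refl
... | false = refl
countOfSize-0 (suc n) p = begin
  countOfSize p 0                                              ≡⟨ countOfSize-suc n p 0 ⟩
  countOfSize (p ∘ (outside ∷_)) 0 + countB _ (allSubsets n)  ≡⟨ cong₂ _+_ (countOfSize-0 n (p ∘ (outside ∷_)))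
                                                                    (countB-none _ (allSubsets n) (λ F → ∧-zeroʳ (p (inside ∷ F)))) ⟩
  indicator (p ⊥) + 0                                          ≡⟨ +-comm _ 0 ⟩
  indicator (p ⊥)                                              ∎
  where open ≡-Reasoning

countOfSize-1 : ∀ n (p : Subset n → Bool) → countOfSize p 1 ≡ ∑[ i < n ] indicator (p ⁅ i ⁆)
countOfSize-1 zero    p = countB-none _ (allSubsets 0) (λ F → ∧-zeroʳ (p F))
countOfSize-1 (suc n) p = begin
  countOfSize p 1                                                   ≡⟨ countOfSize-suc n p 1 ⟩
  countOfSize (p ∘ (outside ∷_)) 1 + countOfSize (p ∘ (inside ∷_)) 0 ≡⟨ cong₂ _+_ (countOfSize-1 n (p ∘ (outside ∷_)))
                                                                         (countOfSize-0 n (p ∘ (inside ∷_))) ⟩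
  ∑[ i < n ] indicator (p ⁅ suc i ⁆) + indicator (p ⁅ zero ⁆)        ≡⟨ +-comm _ (indicator (p ⁅ zero ⁆)) ⟩
  ∑[ i < suc n ] indicator (p ⁅ i ⁆)                                 ∎
  where open ≡-Reasoning

pair : ∀ {n} → Fin n → Fin n → Subset n
pair i j = ⁅ i ⁆ ∪ ⁅ j ⁆

countOfSize-2 : ∀ n (p : Subset n → Bool) → countOfSize p 2 ≡ countPairs (λ i j → p (pair i j))
countOfSize-2 zero    p = countB-none _ (allSubsets 0) (λ F → ∧-zeroʳ (p F))
countOfSize-2 (suc n) p = begin
  countOfSize p 2                                                   ≡⟨ countOfSize-suc n p 2 ⟩
  countOfSize (p ∘ (outside ∷_)) 2 + countOfSize (p ∘ (inside ∷_)) 1 ≡⟨ cong₂ _+_ (countOfSize-2 n (p ∘ (outside ∷_)))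
                                                                         (countOfSize-1 n (p ∘ (inside ∷_))) ⟩
  rest + ∑[ j < n ] indicator (p (inside ∷ ⁅ j ⁆))                   ≡⟨ +-comm rest _ ⟩
  ∑[ j < n ] indicator (p (inside ∷ ⁅ j ⁆)) + rest                   ≡⟨ cong (_+ rest) (sum-cong-≗ (λ j →
                                                                         cong (λ s → indicator (p (inside ∷ s))) (sym (∪-identityˡ ⁅ j ⁆)))) ⟩
  countPairs (λ i j → p (pair i j))                                 ∎
  where
  open ≡-Reasoning
  rest = countPairs (λ i j → p (pair (suc i) (suc j)))

countOfSize≡0⁺ : ∀ {n} (p : Subset n → Bool) k → (∀ F → ∣ F ∣ˢ ≡ k → p F ≡ false) → countOfSize p k ≡ 0
countOfSize≡0⁺ {n} p k none = countB-none _ (allSubsets n) excluded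
  where
  excluded : ∀ F → p F ∧ (∣ F ∣ˢ ≡ᵇ k) ≡ false
  excluded F with ∣ F ∣ˢ ≡ᵇ k in size
  ... | false = ∧-zeroʳ (p F)
  ... | true  = trans (∧-identityʳ (p F)) (none F (≡ᵇ⇒≡ ∣ F ∣ˢ k (Equivalence.from T-≡ size)))

countOfSize≡0⁻ : ∀ {n} (p : Subset n → Bool) k → countOfSize p k ≡ 0 → ∀ F → ∣ F ∣ˢ ≡ k → p F ≡ false
countOfSize≡0⁻ {n} p k none F size = begin
  p F                 ≡⟨ ∧-identityʳ (p F) ⟨
  p F ∧ true          ≡⟨ cong (p F ∧_) (Equivalence.to T-≡ (≡⇒≡ᵇ ∣ F ∣ˢ k size)) ⟨
  p F ∧ (∣ F ∣ˢ ≡ᵇ k)  ≡⟨ countB≡0⇒false _ (allSubsets n) none (∈-allSubsets n F) ⟩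
  false               ∎
  where open ≡-Reasoning

countOfSize-above : ∀ {n} (p : Subset n → Bool) m k → (∀ F → p F ≡ true → ∣ F ∣ˢ ≤ m) → m < k → countOfSize p k ≡ 0
countOfSize-above p m k bound m<k = countOfSize≡0⁺ p k λ F size → ¬-not λ pF → <⇒≱ m<k (subst (_≤ m) size (bound F pF))

∈-pairˡ : ∀ {n} (i j : Fin n) → i ∈ pair i j
∈-pairˡ i j = p⊆p∪q ⁅ j ⁆ (x∈⁅x⁆ i)

∈-pairʳ : ∀ {n} (i j : Fin n) → j ∈ pair i j
∈-pairʳ i j = q⊆p∪q ⁅ i ⁆ ⁅ j ⁆ (x∈⁅x⁆ j)

∈-pair⁻ : ∀ {n} {x : Fin n} i j → x ∈ pair i j → x ≡ i ⊎ x ≡ j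
∈-pair⁻ i j x∈ with x∈p∪q⁻ ⁅ i ⁆ ⁅ j ⁆ x∈
... | inj₁ x∈i = inj₁ (x∈⁅y⁆⇒x≡y i x∈i)
... | inj₂ x∈j = inj₂ (x∈⁅y⁆⇒x≡y j x∈j)

pair⊆ : ∀ {n} {i j : Fin n} {F : Subset n} → i ∈ F → j ∈ F → pair i j ⊆ F
pair⊆ {i = i} {j} i∈F j∈F x∈ with ∈-pair⁻ i j x∈
... | inj₁ refl = i∈F
... | inj₂ refl = j∈F

∣p∪q∣≤∣p∣+∣q∣ : ∀ {n} (p q : Subset n) → ∣ p ∪ q ∣ˢ ≤ ∣ p ∣ˢ + ∣ q ∣ˢ
∣p∪q∣≤∣p∣+∣q∣ []            []            = z≤n
∣p∪q∣≤∣p∣+∣q∣ (outside ∷ p) (outside ∷ q) = ∣p∪q∣≤∣p∣+∣q∣ p q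
∣p∪q∣≤∣p∣+∣q∣ (outside ∷ p) (inside ∷ q)  = subst (suc ∣ p ∪ q ∣ˢ ≤_) (sym (+-suc ∣ p ∣ˢ ∣ q ∣ˢ)) (s≤s (∣p∪q∣≤∣p∣+∣q∣ p q))
∣p∪q∣≤∣p∣+∣q∣ (inside ∷ p)  (outside ∷ q) = s≤s (∣p∪q∣≤∣p∣+∣q∣ p q)
∣p∪q∣≤∣p∣+∣q∣ (inside ∷ p)  (inside ∷ q)  = s≤s (≤-trans (∣p∪q∣≤∣p∣+∣q∣ p q) (+-monoʳ-≤ ∣ p ∣ˢ (n≤1+n ∣ q ∣ˢ)))

∣pair∣≤2 : ∀ {n} (i j : Fin n) → ∣ pair i j ∣ˢ ≤ 2
∣pair∣≤2 i j = subst₂ (λ a b → ∣ pair i j ∣ˢ ≤ a + b) (∣⁅x⁆∣≡1 i) (∣⁅x⁆∣≡1 j) (∣p∪q∣≤∣p∣+∣q∣ ⁅ i ⁆ ⁅ j ⁆)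

∣pair∪⁅_⁆∣≡3 : ∀ {n} {i j : Fin n} k → i ≢ j → j ≢ k → i ≢ k → ∣ pair i j ∪ ⁅ k ⁆ ∣ˢ ≡ 3
∣pair∪⁅_⁆∣≡3 {i = i} {j} k i≢j j≢k i≢k = ≤-antisym upper lower
  where
  upper : ∣ pair i j ∪ ⁅ k ⁆ ∣ˢ ≤ 3
  upper = ≤-trans (∣p∪q∣≤∣p∣+∣q∣ (pair i j) ⁅ k ⁆)
                  (subst (λ c → ∣ pair i j ∣ˢ + c ≤ 3) (sym (∣⁅x⁆∣≡1 k)) (+-monoˡ-≤ 1 (∣pair∣≤2 i j)))
  k∉pair : k ∉ pair i j
  k∉pair k∈ = [ i≢k ∘ sym , j≢k ∘ sym ] (∈-pair⁻ i j k∈)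
  lower : 3 ≤ ∣ pair i j ∪ ⁅ k ⁆ ∣ˢ
  lower = ≤-trans (s≤s (subst (λ c → suc c ≤ ∣ pair i j ∣ˢ) (∣⁅x⁆∣≡1 i)
                         (p⊂q⇒∣p∣<∣q∣ (p⊆p∪q ⁅ j ⁆ , j , ∈-pairʳ i j , x≢y⇒x∉⁅y⁆ (i≢j ∘ sym)))))
                  (p⊂q⇒∣p∣<∣q∣ (p⊆p∪q ⁅ k ⁆ , k , q⊆p∪q (pair i j) ⁅ k ⁆ (x∈⁅x⁆ k) , k∉pair))

member : ∀ {n} (F : Subset n) → 1 ≤ ∣ F ∣ˢ → ∃[ x ] x ∈ F
member (inside ∷ F)  _ = zero , here
member (outside ∷ F) h = let x , x∈F = member F h in suc x , there x∈F

twoMembers : ∀ {n} (F : Subset n) → 2 ≤ ∣ F ∣ˢ → ∃[ x ] ∃[ y ] (x ∈ F × y ∈ F × x ≢ y)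
twoMembers (inside ∷ F)  (s≤s h) = let y , y∈F = member F h in zero , suc y , here , there y∈F , λ ()
twoMembers (outside ∷ F) h = let x , y , x∈F , y∈F , x≢y = twoMembers F h in
  suc x , suc y , there x∈F , there y∈F , x≢y ∘ suc-injective

threeMembers : ∀ {n} (F : Subset n) → 3 ≤ ∣ F ∣ˢ →
  ∃[ x ] ∃[ y ] ∃[ z ] (x ∈ F × y ∈ F × z ∈ F × x ≢ y × y ≢ z × x ≢ z)
threeMembers (inside ∷ F)  (s≤s h) = let y , z , y∈F , z∈F , y≢z = twoMembers F h in
  zero , suc y , suc z , here , there y∈F , there z∈F , (λ ()) , y≢z ∘ suc-injective , λ ()
threeMembers (outside ∷ F) h = let x , y , z , x∈F , y∈F , z∈F , x≢y , y≢z , x≢z = threeMembers F h in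
  suc x , suc y , suc z , there x∈F , there y∈F , there z∈F , x≢y ∘ suc-injective , y≢z ∘ suc-injective , x≢z ∘ suc-injective

-- Edges and the two complexes of an edge ideal

adj⇒≢ : ∀ {n} (G : Graph n) {u v} → adj G u v ≡ true → u ≢ v
adj⇒≢ G {u} uv refl with trans (sym uv) (adj-irrefl G u)
... | ()

adjᶜ≡not : ∀ {n} (G : Graph n) {u v} → u ≢ v → adj (complement G) u v ≡ not (adj G u v)
adjᶜ≡not G {u} {v} u≢v with u ≟ v
... | yes u≡v = contradiction u≡v u≢v
... | no _    = refl

adjᶜ⇒¬adj : ∀ {n} (G : Graph n) {u v} → adj (complement G) u v ≡ true → adj G u v ≡ false
adjᶜ⇒¬adj G {u} {v} uvᶜ = not-injective (trans (sym (adjᶜ≡not G (adj⇒≢ (complement G) uvᶜ))) uvᶜ)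

Independent : ∀ {n} → Graph n → Subset n → Set
Independent G F = ∀ {u v} → u ∈ F → v ∈ F → adj G u v ≡ false

module _ {n : ℕ} (G : Graph n) where

  δN δF : Complex n
  δN = nonFaceComplex (edgeIdeal G)
  δF = facetComplex (edgeIdeal G)

  ∈-edges⁺-< : ∀ {u v} → toℕ u < toℕ v → adj G u v ≡ true → pair u v ∈ₗ edges G
  ∈-edges⁺-< {u} {v} u<v uv = ∈-concatMap⁺ _ (lose (∈-allFin u) (∈-concatMap⁺ _ (lose (∈-allFin v) listed)))
    where
    listed : pair u v ∈ₗ (if (toℕ u <ᵇ toℕ v) ∧ adj G u v then pair u v ∷ [] else [])
    listed rewrite Equivalence.to T-≡ (<⇒<ᵇ u<v) | uv = here refl

  ∈-edges⁺ : ∀ {u v} → adj G u v ≡ true → pair u v ∈ₗ edges G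
  ∈-edges⁺ {u} {v} uv with <-cmp u v
  ... | tri< u<v _ _ = ∈-edges⁺-< u<v uv
  ... | tri≈ _ u≡v _ = contradiction u≡v (adj⇒≢ G uv)
  ... | tri> _ _ v<u = subst (_∈ₗ edges G) (∪-comm ⁅ v ⁆ ⁅ u ⁆) (∈-edges⁺-< v<u (trans (adj-sym G v u) uv))

  ∈-edges⁻ : ∀ {g} → g ∈ₗ edges G → ∃[ u ] ∃[ v ] (adj G u v ≡ true × g ≡ pair u v)
  ∈-edges⁻ g∈ with find (∈-concatMap⁻ _ {xs = allFin n} g∈)
  ... | u , _ , g∈row with find (∈-concatMap⁻ _ {xs = allFin n} g∈row)
  ... | v , _ , g∈cell with ∈-if⁻ ((toℕ u <ᵇ toℕ v) ∧ adj G u v) g∈cell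
  ... | listed , g≡uv = u , v , ∧-conicalʳ (toℕ u <ᵇ toℕ v) (adj G u v) listed , g≡uv

  numEdges≡countPairs : numEdges G ≡ countPairs (adj G)
  numEdges≡countPairs = trans (length-concatMap-allFin n row) (sum-cong-≗ λ i →
    trans (length-concatMap-allFin n (cell i)) (sum-cong-≗ λ j → length-if _ (pair i j)))
    where
    cell : Fin n → Fin n → List (Subset n)
    cell i j = if (toℕ i <ᵇ toℕ j) ∧ adj G i j then pair i j ∷ [] else []
    row : Fin n → List (Subset n)
    row i = concatMap (cell i) (allFin n)

  nonFace≡true⁺ : ∀ {F} → Independent G F → δN F ≡ true
  nonFace≡true⁺ {F} indep = cong not (¬-not noEdgeInside)
    where
    noEdgeInside : any (λ g → does (g ⊆? F)) (edges G) ≢ true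
    noEdgeInside someEdge with any≡true⁻ _ (edges G) someEdge
    ... | g , g∈ , g⊆F with ∈-edges⁻ g∈
    ... | u , v , uv , refl with does≡true⇒ (pair u v ⊆? F) g⊆F
    ... | uv⊆F with trans (sym uv) (indep (uv⊆F (∈-pairˡ u v)) (uv⊆F (∈-pairʳ u v)))
    ... | ()

  nonFace≡true⁻ : ∀ {F} → δN F ≡ true → Independent G F
  nonFace≡true⁻ {F} nonFace {u} {v} u∈F v∈F = ¬-not edgeInside
    where
    edgeInside : adj G u v ≢ true
    edgeInside uv with trans (sym nonFace) (cong not (any≡true⁺ _ (∈-edges⁺ uv) (dec-true (pair u v ⊆? F) (pair⊆ u∈F v∈F))))
    ... | ()

  facet≡true⁺ : ∀ {F u v} → adj G u v ≡ true → F ⊆ pair u v → δF F ≡ true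
  facet≡true⁺ {F} {u} {v} uv F⊆uv = any≡true⁺ _ (∈-edges⁺ uv) (dec-true (F ⊆? pair u v) F⊆uv)

  facet≡true⁻ : ∀ {F} → δF F ≡ true → ∃[ u ] ∃[ v ] (adj G u v ≡ true × F ⊆ pair u v)
  facet≡true⁻ {F} facet with any≡true⁻ _ (edges G) facet
  ... | g , g∈ , F⊆g with ∈-edges⁻ g∈
  ... | u , v , uv , refl = u , v , uv , does≡true⇒ (F ⊆? pair u v) F⊆g

  pair-independent : ∀ {i j} → adj G i j ≡ false → Independent G (pair i j)
  pair-independent {i} {j} ij u∈ v∈ with ∈-pair⁻ i j u∈ | ∈-pair⁻ i j v∈
  ... | inj₁ refl | inj₁ refl = adj-irrefl G i
  ... | inj₁ refl | inj₂ refl = ij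
  ... | inj₂ refl | inj₁ refl = trans (adj-sym G j i) ij
  ... | inj₂ refl | inj₂ refl = adj-irrefl G j

  adj-spanning-pair : ∀ {i j u v} → i ≢ j → i ∈ pair u v → j ∈ pair u v → adj G u v ≡ true → adj G i j ≡ true
  adj-spanning-pair {u = u} {v} i≢j i∈ j∈ uv with ∈-pair⁻ u v i∈ | ∈-pair⁻ u v j∈
  ... | inj₁ refl | inj₁ refl = contradiction refl i≢j
  ... | inj₁ refl | inj₂ refl = uv
  ... | inj₂ refl | inj₁ refl = trans (adj-sym G v u) uv
  ... | inj₂ refl | inj₂ refl = contradiction refl i≢j

  nonFace-singleton : ∀ i → δN ⁅ i ⁆ ≡ true
  nonFace-singleton i = nonFace≡true⁺ λ u∈ v∈ → ¬-not λ uv → adj⇒≢ G uv (trans (x∈⁅y⁆⇒x≡y i u∈) (sym (x∈⁅y⁆⇒x≡y i v∈)))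

  facet-singleton : NoIsolated G → ∀ i → δF ⁅ i ⁆ ≡ true
  facet-singleton noIsolated i = let j , ij = noIsolated i in facet≡true⁺ ij (p⊆p∪q ⁅ j ⁆)

  nonFace-pair : ∀ i j → δN (pair i j) ≡ not (adj G i j)
  nonFace-pair i j with adj G i j in ij
  ... | true  = cong not (any≡true⁺ _ (∈-edges⁺ ij) (dec-true (pair i j ⊆? pair i j) id))
  ... | false = nonFace≡true⁺ (pair-independent ij)

  facet-pair : ∀ {i j} → i ≢ j → δF (pair i j) ≡ adj G i j
  facet-pair {i} {j} i≢j = ⇔→≡ (mk⇔ spanned (λ ij → facet≡true⁺ ij id))
    where
    spanned : δF (pair i j) ≡ true → adj G i j ≡ true
    spanned facet with facet≡true⁻ facet
    ... | u , v , uv , ij⊆uv = adj-spanning-pair i≢j (ij⊆uv (∈-pairˡ i j)) (ij⊆uv (∈-pairʳ i j)) uv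

  facet⇒∣F∣≤2 : ∀ F → δF F ≡ true → ∣ F ∣ˢ ≤ 2
  facet⇒∣F∣≤2 F facet with facet≡true⁻ {F} facet
  ... | u , v , _ , F⊆uv = ≤-trans (p⊆q⇒∣p∣≤∣q∣ F⊆uv) (∣pair∣≤2 u v)

  independent⇒∣F∣≤2 : TriangleFree (complement G) → ∀ F → Independent G F → ∣ F ∣ˢ ≤ 2
  independent⇒∣F∣≤2 triangleFree F indep with ∣ F ∣ˢ ≤? 2
  ... | yes ∣F∣≤2 = ∣F∣≤2
  ... | no ∣F∣≰2 with threeMembers F (≰⇒> ∣F∣≰2)
  ... | x , y , z , x∈ , y∈ , z∈ , x≢y , y≢z , x≢z =
    contradiction (x , y , z , edgeᶜ x≢y (indep x∈ y∈) , edgeᶜ y≢z (indep y∈ z∈) , edgeᶜ x≢z (indep x∈ z∈)) triangleFree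
    where
    edgeᶜ : ∀ {u v} → u ≢ v → adj G u v ≡ false → adj (complement G) u v ≡ true
    edgeᶜ u≢v uv = trans (adjᶜ≡not G u≢v) (cong not uv)

  triangleᶜ⇒independent : ∀ {i j k} → adj (complement G) i j ≡ true → adj (complement G) j k ≡ true →
    adj (complement G) i k ≡ true → Independent G (pair i j ∪ ⁅ k ⁆)
  triangleᶜ⇒independent {i} {j} {k} ij jk ik u∈ v∈ = nonadjacent (corner u∈) (corner v∈)
    where
    corner : ∀ {x} → x ∈ pair i j ∪ ⁅ k ⁆ → x ≡ i ⊎ x ≡ j ⊎ x ≡ k
    corner x∈ with x∈p∪q⁻ (pair i j) ⁅ k ⁆ x∈
    ... | inj₁ x∈ij = map₂ inj₁ (∈-pair⁻ i j x∈ij)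
    ... | inj₂ x∈k  = inj₂ (inj₂ (x∈⁅y⁆⇒x≡y k x∈k))
    nonadjacent : ∀ {u v} → u ≡ i ⊎ u ≡ j ⊎ u ≡ k → v ≡ i ⊎ v ≡ j ⊎ v ≡ k → adj G u v ≡ false
    nonadjacent (inj₁ refl)        (inj₁ refl)        = adj-irrefl G i
    nonadjacent (inj₂ (inj₁ refl)) (inj₂ (inj₁ refl)) = adj-irrefl G j
    nonadjacent (inj₂ (inj₂ refl)) (inj₂ (inj₂ refl)) = adj-irrefl G k
    nonadjacent (inj₁ refl)        (inj₂ (inj₁ refl)) = adjᶜ⇒¬adj G ij
    nonadjacent (inj₂ (inj₁ refl)) (inj₂ (inj₂ refl)) = adjᶜ⇒¬adj G jk
    nonadjacent (inj₁ refl)        (inj₂ (inj₂ refl)) = adjᶜ⇒¬adj G ik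
    nonadjacent (inj₂ (inj₁ refl)) (inj₁ refl)        = trans (adj-sym G j i) (adjᶜ⇒¬adj G ij)
    nonadjacent (inj₂ (inj₂ refl)) (inj₂ (inj₁ refl)) = trans (adj-sym G k j) (adjᶜ⇒¬adj G jk)
    nonadjacent (inj₂ (inj₂ refl)) (inj₁ refl)        = trans (adj-sym G k i) (adjᶜ⇒¬adj G ik)

  -- f-vectors

  f₀-nonFace : fvec δN 0 ≡ n
  f₀-nonFace = trans (countOfSize-1 n δN) (trans (sum-cong-≗ (cong indicator ∘ nonFace-singleton)) (∑-const-1 n))

  f₀-facet : NoIsolated G → fvec δF 0 ≡ n
  f₀-facet noIsolated = trans (countOfSize-1 n δF) (trans (sum-cong-≗ (cong indicator ∘ facet-singleton noIsolated)) (∑-const-1 n))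

  f₁-facet≡numEdges : fvec δF 1 ≡ numEdges G
  f₁-facet≡numEdges = trans (countOfSize-2 n δF)
    (trans (countPairs-cong (λ i j i<j → facet-pair (<⇒≢ i<j))) (sym numEdges≡countPairs))

  f₁-nonFace+numEdges : fvec δN 1 + numEdges G ≡ n C 2
  f₁-nonFace+numEdges = trans (cong₂ _+_ f₁-nonFace numEdges≡countPairs) (countPairs-complement n (adj G))
    where
    f₁-nonFace : fvec δN 1 ≡ countPairs (λ i j → not (adj G i j))
    f₁-nonFace = trans (countOfSize-2 n δN) (countPairs-cong (λ i j _ → nonFace-pair i j))

  facet-fvec-vanishes : ∀ i → 2 ≤ i → fvec δF i ≡ 0
  facet-fvec-vanishes i 2≤i = countOfSize-above δF 2 (suc i) facet⇒∣F∣≤2 (s≤s 2≤i)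

  nonFace-fvec-vanishes : TriangleFree (complement G) → ∀ i → 2 ≤ i → fvec δN i ≡ 0
  nonFace-fvec-vanishes triangleFree i 2≤i =
    countOfSize-above δN 2 (suc i) (λ F → independent⇒∣F∣≤2 triangleFree F ∘ nonFace≡true⁻) (s≤s 2≤i)

  f₂-nonFace≡0⇒triangleFree : fvec δN 2 ≡ 0 → TriangleFree (complement G)
  f₂-nonFace≡0⇒triangleFree f₂≡0 (i , j , k , ij , jk , ik) = not-¬ triangleFace (countOfSize≡0⁻ δN 3 f₂≡0 _ size)
    where
    triangleFace : δN (pair i j ∪ ⁅ k ⁆) ≡ true
    triangleFace = nonFace≡true⁺ (triangleᶜ⇒independent ij jk ik)
    size : ∣ pair i j ∪ ⁅ k ⁆ ∣ˢ ≡ 3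
    size = ∣pair∪⁅ k ⁆∣≡3 (adj⇒≢ (complement G) ij) (adj⇒≢ (complement G) jk) (adj⇒≢ (complement G) ik)

sum-and-double⇒difference : ∀ (x y c b : ℤ) → x ℤ.+ y ≡ c → + 2 * y ≡ c - b → x - y ≡ b
sum-and-double⇒difference x y c b x+y≡c 2y≡c-b = begin
  x - y                ≡⟨ regroup x y ⟩
  (x ℤ.+ y) - + 2 * y  ≡⟨ cong₂ _-_ x+y≡c 2y≡c-b ⟩
  c - (c - b)          ≡⟨ cancel c b ⟩
  b                    ∎
  where
  open ≡-Reasoning
  regroup : ∀ x y → x - y ≡ (x ℤ.+ y) - + 2 * y
  regroup = solve-∀
  cancel : ∀ c b → c - (c - b) ≡ b
  cancel = solve-∀

theorem3p4 : (n : ℕ) (b : ℤ) (G : Graph n) →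
    ∣ b ∣ < n C 2 →
    NoIsolated G →
    (+ 2) * (+ numEdges G) ≡ (+ (n C 2)) - b →
    (IsQuasiFGraph G ((+ 0) ∷ b ∷ []) ⇔ TriangleFree (complement G))
theorem3p4 n b G _ noIsolated edgeCount = mk⇔ (f₂-nonFace≡0⇒triangleFree G ∘ f₂-vanishes) quasiF
  where
  f₂-vanishes : IsQuasiFGraph G ((+ 0) ∷ b ∷ []) → fvec (δN G) 2 ≡ 0
  f₂-vanishes (_ , beyond) = proj₁ (beyond 2 ≤-refl)
  quasiF : TriangleFree (complement G) → IsQuasiFGraph G ((+ 0) ∷ b ∷ [])
  quasiF triangleFree = entries , λ i 2≤i → nonFace-fvec-vanishes G triangleFree i 2≤i , facet-fvec-vanishes G i 2≤i
    where
    entries : (i : Fin 2) → + fvec (δN G) (toℕ i) - + fvec (δF G) (toℕ i) ≡ lookup ((+ 0) ∷ b ∷ []) i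
    entries zero       = trans (cong₂ (λ x y → + x - + y) (f₀-nonFace G) (f₀-facet G noIsolated)) (+-inverseʳ (+ n))
    entries (suc zero) = sum-and-double⇒difference (+ f₁ᴺ) (+ f₁ᶠ) (+ (n C 2)) b
      (trans (sym (pos-+ f₁ᴺ f₁ᶠ)) (cong +_ (trans (cong₂ _+_ refl (f₁-facet≡numEdges G)) (f₁-nonFace+numEdges G))))
      (trans (cong (λ e → + 2 * + e) (f₁-facet≡numEdges G)) edgeCount)
      where
      f₁ᴺ f₁ᶠ : ℕ
      f₁ᴺ = fvec (δN G) 1
      f₁ᶠ = fvec (δF G) 1
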